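{- Let $n,m\geq 2$ and let $G\in\mathcal{O}(K_{n,m})$ be a graph locally equivalent to the complete bipartite graph $K_{n,m}$. Then $G$ has the minimum number of edges among all graphs in $\mathcal{O}(K_{n,m})$ if and only if $G$ is a binary star. In this case $|E(G)|=n+m-1$.
   Context: Local complement $c_v(G)$: replace the subgraph induced on the neighbourhood of vertex $v$ by its complement, leaving all other edges unchanged. The LC orbit $\mathcal{O}(G)$ is the set of labeled graphs on the same vertex set obtainable from $G$ by finite sequences of local complements. A binary star is a graph consisting of two star graphs together with one additional edge joining their centers (i.e. a tree with two adjacent vertices such that every other vertex is adjacent to exactly one of them). -}

module Defs where

open import Data.Bool using (Bool; true; false; not; _∧_; _xor_; if_then_else_)
open import Data.Nat using (ℕ; _<ᵇ_; _≤_)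
open import Data.Nat.ListAction using (sum)
open import Data.Fin using (Fin; toℕ; _≟_)
open import Data.List using (map; allFin)
open import Data.Product using (Σ; _×_; ∃)
open import Relation.Nullary using (¬_; does)
open import Relation.Binary.PropositionalEquality using (_≡_)

Graph : ℕ → Set
Graph N = Fin N → Fin N → Bool

lc : ∀ {N} → Fin N → Graph N → Graph N
lc v G x y = if (not (does (x ≟ y)) ∧ G v x ∧ G v y) then not (G x y) else G x y

_≈G_ : ∀ {N} → Graph N → Graph N → Set
G ≈G H = ∀ x y → G x y ≡ H x y

data InOrbit {N} (G : Graph N) : Graph N → Set where
  here : ∀ {H} → G ≈G H → InOrbit G H
  step : ∀ {H H'} (v : Fin N) → InOrbit G H → lc v H ≈G H' → InOrbit G H'

-- Complete bipartite graph K_{n,m} on Fin (n + m): parts {0..n-1} and {n..n+m-1}.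
K : (n m : ℕ) → Graph (n Data.Nat.+ m)
K n m x y = (toℕ x <ᵇ n) xor (toℕ y <ᵇ n)

edges : ∀ {N} → Graph N → ℕ
edges {N} G = sum (map (λ x → sum (map (λ y →
  if (toℕ x <ᵇ toℕ y) ∧ G x y then 1 else 0) (allFin N))) (allFin N))

IsMinInOrbit : ∀ {N} → Graph N → Graph N → Set
IsMinInOrbit G₀ G = ∀ H → InOrbit G₀ H → edges G ≤ edges H

IsBinaryStar : ∀ {N} → Graph N → Set
IsBinaryStar {N} G = Σ (Fin N) λ a → Σ (Fin N) λ b →
  ¬ (a ≡ b) × G a b ≡ true ×
  (∀ x → ¬ (x ≡ a) → ¬ (x ≡ b) → (G a x xor G b x) ≡ true) ×
  (∀ x y → ¬ (x ≡ a) → ¬ (x ≡ b) → ¬ (y ≡ a) → ¬ (y ≡ b) → G x y ≡ false)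

-- Local complementation keeps K_{A,B} inside six families of graphs, each determined by the
-- bipartition together with two centres a ∈ A and b ∈ B: K_{A,B} itself, K_{A,B} plus a clique on
-- A (or on B), the binary star with centres a and b, and a clique on A (or B) plus the hub b
-- (or a) joined to every other vertex. How one local complementation moves between these families
-- is a finite table, checked by evaluating it on every consistent assignment of the equality and
-- side atoms of the five vertices involved. By the handshake lemma a binary star has n + m - 1
-- edges; every other member has more, since K_{A,B} has minimum degree 2 when both sides have at
-- least two vertices, and each hub graph properly contains a binary star. Complementing K_{A,B}
-- at a, b, a produces a binary star, so the minimum over the orbit is n + m - 1.
module Submission where

open import Defs
import Algebra.Properties.CommutativeMonoid.Sum as Sum
import Algebra.Properties.CommutativeSemigroup as CommutativeSemigroup
open import Data.Bool using (Bool; true; false; not; _∧_; _∨_; _xor_; if_then_else_)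
open import Data.Bool.Properties using (T-≡; ∧-zeroʳ; not-involutive)
open import Data.Empty using (⊥-elim)
open import Data.Fin using (Fin; zero; suc; toℕ; _≟_; _↑ʳ_)
open import Data.Fin.Properties using (toℕ-injective; toℕ-↑ʳ; ↑ʳ-injective; 0≢1+n)
open import Data.List using (map; tabulate; allFin)
import Data.Nat.ListAction as List
open import Data.Nat using (ℕ; zero; suc; _+_; _∸_; _≤_; _<_; _<ᵇ_; z≤n; s≤s)
open import Data.Nat.Properties
  using (+-0-commutativeMonoid; +-commutativeSemigroup; module ≤-Reasoning;
         +-comm; +-suc; +-identityʳ; suc-injective; m+n∸n≡m; <-cmp; <⇒<ᵇ; <ᵇ⇒<;
         ≤-refl; ≤-reflexive; ≤-trans; <-≤-trans; <⇒≤; <⇒≱; ≮⇒≥; ≤⇒≯; m≤m+n; m≤n+m;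
         +-mono-≤; +-monoʳ-≤; +-mono-<; +-mono-<-≤; +-mono-≤-<)
open import Data.Product using (Σ; _×_; _,_; proj₁; proj₂)
open import Data.Sum using (_⊎_; inj₁; inj₂)
open import Data.Vec using (Vec; []; _∷_)
open import Function using (_∘_)
open import Function.Bundles using (Equivalence)
open import Relation.Binary.Definitions using (tri<; tri≈; tri>)
open import Relation.Binary.PropositionalEquality
  using (_≡_; refl; sym; trans; cong; cong₂; subst; subst₂; module ≡-Reasoning)
open import Relation.Nullary using (¬_; does; yes; no; contradiction)

open Sum +-0-commutativeMonoid using (sum; sum-syntax; ∑-distrib-+; ∑-comm; sum-cong-≗)
open CommutativeSemigroup +-commutativeSemigroup using (interchange)

infixr 6 _⇒ᵇ_
infix 7 _==_

_⇒ᵇ_ : Bool → Bool → Bool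
false ⇒ᵇ _ = true
true  ⇒ᵇ b = b

_==_ : Bool → Bool → Bool
a == b = not (a xor b)

==-sound : ∀ {a b} → (a == b) ≡ true → a ≡ b
==-sound {true}  {true}  _ = refl
==-sound {false} {false} _ = refl

⇒ᵇ-elim : ∀ {a b} → (a ⇒ᵇ b) ≡ true → a ≡ true → b ≡ true
⇒ᵇ-elim h refl = h

infixr 4 _⟨∧⟩_

_⟨∧⟩_ : ∀ {a b} → a ≡ true → b ≡ true → a ∧ b ≡ true
refl ⟨∧⟩ h = h

isTautology : ∀ n → (Vec Bool n → Bool) → Bool
isTautology zero    f = f []
isTautology (suc n) f = isTautology n (f ∘ (true ∷_)) ∧ isTautology n (f ∘ (false ∷_))

isTautology-sound : ∀ n f → isTautology n f ≡ true → ∀ v → f v ≡ true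
isTautology-sound zero    f h [] = h
isTautology-sound (suc n) f h (true ∷ v)  = isTautology-sound n _ (∧-true₁ h) v
  where
  ∧-true₁ : ∀ {a b} → a ∧ b ≡ true → a ≡ true
  ∧-true₁ {true} _ = refl
isTautology-sound (suc n) f h (false ∷ v) = isTautology-sound n _ (∧-true₂ h) v
  where
  ∧-true₂ : ∀ {a b} → a ∧ b ≡ true → b ≡ true
  ∧-true₂ {true} h = h

ind : Bool → ℕ
ind b = if b then 1 else 0

ind-mono : ∀ {a b} → (a ≡ true → b ≡ true) → ind a ≤ ind b
ind-mono {false} _ = z≤n
ind-mono {true}  h rewrite h refl = ≤-refl

ind-xor : ∀ a b → (a xor b) ≡ true → ind a + ind b ≡ 1
ind-xor true  false _ = refl
ind-xor false true  _ = refl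

∑-one : ∀ N → ∑[ x < N ] 1 ≡ N
∑-one zero    = refl
∑-one (suc N) = cong suc (∑-one N)

∑-mono-≤ : ∀ {N} {f g : Fin N → ℕ} → (∀ x → f x ≤ g x) → sum f ≤ sum g
∑-mono-≤ {zero}  _ = z≤n
∑-mono-≤ {suc N} h = +-mono-≤ (h zero) (∑-mono-≤ (h ∘ suc))

∑-mono-< : ∀ {N} {f g : Fin N → ℕ} → (∀ x → f x ≤ g x) → ∀ i → f i < g i → sum f < sum g
∑-mono-< {suc N} h zero    lt = +-mono-<-≤ lt (∑-mono-≤ (h ∘ suc))
∑-mono-< {suc N} h (suc i) lt = +-mono-≤-< (h zero) (∑-mono-< (h ∘ suc) i lt)

∑-≥-point : ∀ {N} (f : Fin N → ℕ) i → f i ≤ sum f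
∑-≥-point f zero    = m≤m+n _ _
∑-≥-point f (suc i) = ≤-trans (∑-≥-point (f ∘ suc) i) (m≤n+m _ _)

∑-≥-pair : ∀ {N} (f : Fin N → ℕ) {i j} → ¬ i ≡ j → f i + f j ≤ sum f
∑-≥-pair f {zero}  {zero}  i≢j = ⊥-elim (i≢j refl)
∑-≥-pair f {zero}  {suc j} _   = +-monoʳ-≤ (f zero) (∑-≥-point (f ∘ suc) j)
∑-≥-pair f {suc i} {zero}  _   =
  subst (_≤ sum f) (+-comm (f zero) (f (suc i))) (+-monoʳ-≤ (f zero) (∑-≥-point (f ∘ suc) i))
∑-≥-pair f {suc i} {suc j} i≢j =
  ≤-trans (∑-≥-pair (f ∘ suc) (i≢j ∘ cong suc)) (m≤n+m _ (f zero))

sum-map-tabulate : ∀ {A : Set} {N} (g : Fin N → A) (f : A → ℕ) →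
  List.sum (map f (tabulate g)) ≡ sum (f ∘ g)
sum-map-tabulate {N = zero}  g f = refl
sum-map-tabulate {N = suc N} g f = cong (f (g zero) +_) (sum-map-tabulate (g ∘ suc) f)

+-double-injective : ∀ m n → m + m ≡ n + n → m ≡ n
+-double-injective zero    zero    _ = refl
+-double-injective (suc m) (suc n) h = cong suc (+-double-injective m n
  (suc-injective (trans (sym (+-suc m m)) (trans (suc-injective h) (+-suc n n)))))

+-double-cancel-≤ : ∀ {m n} → m + m ≤ n + n → m ≤ n
+-double-cancel-≤ h = ≮⇒≥ (λ n<m → <⇒≱ (+-mono-< n<m n<m) h)

<ᵇ-true : ∀ {m n} → m < n → (m <ᵇ n) ≡ true
<ᵇ-true m<n = Equivalence.to T-≡ (<⇒<ᵇ m<n)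

<ᵇ-false : ∀ {m n} → ¬ m < n → (m <ᵇ n) ≡ false
<ᵇ-false {m} {n} m≮n with m <ᵇ n in eq
... | false = refl
... | true  = ⊥-elim (m≮n (<ᵇ⇒< m n (Equivalence.from T-≡ eq)))

point : ∀ {N} → Fin N → ℕ → Fin N → ℕ
point c k x = if does (x ≟ c) then k else 0

∑-point : ∀ {N} (c : Fin N) k → sum (point c k) ≡ k
∑-point {suc N} zero    k = trans (cong (k +_) (∑-zero N)) (+-identityʳ k)
  where
  ∑-zero : ∀ N → ∑[ x < N ] 0 ≡ 0
  ∑-zero zero    = refl
  ∑-zero (suc N) = ∑-zero N
∑-point {suc N} (suc c) k = ∑-point c k

-- Graphs and their edge counts

_≺_ : ∀ {N} → Fin N → Fin N → Bool
x ≺ y = toℕ x <ᵇ toℕ y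

Symmetric : ∀ {N} → Graph N → Set
Symmetric G = ∀ x y → G x y ≡ G y x

Irreflexive : ∀ {N} → Graph N → Set
Irreflexive G = ∀ x → G x x ≡ false

_⊆ᴳ_ : ∀ {N} → Graph N → Graph N → Set
G ⊆ᴳ H = ∀ x y → G x y ≡ true → H x y ≡ true

deg : ∀ {N} → Graph N → Fin N → ℕ
deg {N} G x = ∑[ y < N ] ind (G x y)

edges-as-∑ : ∀ {N} (G : Graph N) → edges G ≡ ∑[ x < N ] ∑[ y < N ] ind (x ≺ y ∧ G x y)
edges-as-∑ {N} G = trans
  (sum-map-tabulate (λ x → x) (λ x → List.sum (map (λ y → ind (x ≺ y ∧ G x y)) (allFin N))))
  (sum-cong-≗ (λ x → sum-map-tabulate (λ y → y) (λ y → ind (x ≺ y ∧ G x y))))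

edges-cong : ∀ {N} {G H : Graph N} → G ≈G H → edges G ≡ edges H
edges-cong {G = G} {H} G≈H = trans (edges-as-∑ G) (trans
  (sum-cong-≗ (λ x → sum-cong-≗ (λ y → cong (λ c → ind (x ≺ y ∧ c)) (G≈H x y))))
  (sym (edges-as-∑ H)))

∧-monoʳ : ∀ a {b c} → (b ≡ true → c ≡ true) → a ∧ b ≡ true → a ∧ c ≡ true
∧-monoʳ true h = h

edges-mono : ∀ {N} {G H : Graph N} → G ⊆ᴳ H → edges G ≤ edges H
edges-mono {G = G} {H} G⊆H =
  subst₂ _≤_ (sym (edges-as-∑ G)) (sym (edges-as-∑ H))
    (∑-mono-≤ (λ x → ∑-mono-≤ (λ y → ind-mono (∧-monoʳ (x ≺ y) (G⊆H x y)))))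

edges-mono-< : ∀ {N} {G H : Graph N} → G ⊆ᴳ H →
  ∀ x y → x ≺ y ≡ true → G x y ≡ false → H x y ≡ true → edges G < edges H
edges-mono-< {G = G} {H} G⊆H x y x≺y Gxy Hxy =
  subst₂ _<_ (sym (edges-as-∑ G)) (sym (edges-as-∑ H))
    (∑-mono-< (λ x → ∑-mono-≤ (λ y → ind-mono (∧-monoʳ (x ≺ y) (G⊆H x y)))) x
      (∑-mono-< (λ y → ind-mono (∧-monoʳ (x ≺ y) (G⊆H x y))) y new-edge))
  where
  new-edge : ind (x ≺ y ∧ G x y) < ind (x ≺ y ∧ H x y)
  new-edge rewrite x≺y | Gxy | Hxy = ≤-refl

ind-split : ∀ {N} {G : Graph N} → Irreflexive G →
  ∀ x y → ind (G x y) ≡ ind (x ≺ y ∧ G x y) + ind (y ≺ x ∧ G x y)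
ind-split {G = G} irr x y with <-cmp (toℕ x) (toℕ y)
... | tri< x<y _ y≮x rewrite <ᵇ-true x<y | <ᵇ-false y≮x = sym (+-identityʳ _)
... | tri> x≮y _ y<x rewrite <ᵇ-false x≮y | <ᵇ-true y<x = refl
... | tri≈ _ x≡y _ with toℕ-injective x≡y
...   | refl rewrite irr x | ∧-zeroʳ (x ≺ x) = refl

handshake : ∀ {N} {G : Graph N} → Symmetric G → Irreflexive G →
  edges G + edges G ≡ ∑[ x < N ] deg G x
handshake {N} {G} sym-G irr = begin
  edges G + edges G
    ≡⟨ cong₂ _+_ (edges-as-∑ G) (trans (edges-as-∑ G) (∑-comm (λ x y → ind (x ≺ y ∧ G x y)))) ⟩
  ∑[ x < N ] ∑[ y < N ] ind (x ≺ y ∧ G x y) + ∑[ x < N ] ∑[ y < N ] ind (y ≺ x ∧ G y x)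
    ≡⟨ cong (∑[ x < N ] ∑[ y < N ] ind (x ≺ y ∧ G x y) +_)
            (sum-cong-≗ (λ x → sum-cong-≗ (λ y → cong (λ c → ind (y ≺ x ∧ c)) (sym-G y x)))) ⟩
  ∑[ x < N ] ∑[ y < N ] ind (x ≺ y ∧ G x y) + ∑[ x < N ] ∑[ y < N ] ind (y ≺ x ∧ G x y)
    ≡⟨ ∑-distrib-+ (λ x → ∑[ y < N ] ind (x ≺ y ∧ G x y))
                   (λ x → ∑[ y < N ] ind (y ≺ x ∧ G x y)) ⟨
  ∑[ x < N ] (∑[ y < N ] ind (x ≺ y ∧ G x y) + ∑[ y < N ] ind (y ≺ x ∧ G x y))
    ≡⟨ sum-cong-≗ (λ x → ∑-distrib-+ (λ y → ind (x ≺ y ∧ G x y)) (λ y → ind (y ≺ x ∧ G x y))) ⟨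
  ∑[ x < N ] ∑[ y < N ] (ind (x ≺ y ∧ G x y) + ind (y ≺ x ∧ G x y))
    ≡⟨ sum-cong-≗ (λ x → sum-cong-≗ (λ y → sym (ind-split irr x y))) ⟩
  ∑[ x < N ] deg G x ∎
  where open ≡-Reasoning

-- Summing deg x + [x = a] + [x = b] = [x = a] deg a + [x = b] deg b + 1 over x
-- gives 2 |E| + 2 = (deg a + deg b) + N = 2 N.
binaryStar-edges : ∀ {N} {G : Graph N} → Symmetric G → Irreflexive G →
  IsBinaryStar G → edges G ≡ N ∸ 1
binaryStar-edges {N} {G} sym-G irr (a , b , a≢b , Gab , one-centre , leaves-independent) = begin
  edges G                 ≡⟨ sym (m+n∸n≡m (edges G) 1) ⟩
  edges G + 1 ∸ 1         ≡⟨ cong (_∸ 1) (+-double-injective (edges G + 1) N doubled) ⟩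
  N ∸ 1                   ∎
  where
  open ≡-Reasoning

  Gba : G b a ≡ true
  Gba = trans (sym-G b a) Gab

  centres-cover : ∀ x → ind (G a x) + ind (G b x) ≡ 1
  centres-cover x with x ≟ a | x ≟ b
  ... | yes refl | _        = cong₂ (λ u v → ind u + ind v) (irr x) Gba
  ... | no _     | yes refl = cong₂ (λ u v → ind u + ind v) Gab (irr x)
  ... | no x≢a   | no x≢b   = ind-xor (G a x) (G b x) (one-centre x x≢a x≢b)

  leaf-degree : ∀ x → ¬ x ≡ a → ¬ x ≡ b → deg G x ≡ 1
  leaf-degree x x≢a x≢b = begin
    deg G x                                              ≡⟨ sum-cong-≗ only-centres ⟩
    ∑[ y < N ] (point a (ind (G x a)) y + point b (ind (G x b)) y)
                                                         ≡⟨ ∑-distrib-+ (point a (ind (G x a))) (point b (ind (G x b))) ⟩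
    sum (point a (ind (G x a))) + sum (point b (ind (G x b)))
                                                         ≡⟨ cong₂ _+_ (∑-point a _) (∑-point b _) ⟩
    ind (G x a) + ind (G x b)                            ≡⟨ cong₂ (λ u v → ind u + ind v) (sym-G x a) (sym-G x b) ⟩
    ind (G a x) + ind (G b x)                            ≡⟨ centres-cover x ⟩
    1                                                    ∎
    where
    only-centres : ∀ y → ind (G x y) ≡ point a (ind (G x a)) y + point b (ind (G x b)) y
    only-centres y with y ≟ a | y ≟ b
    ... | yes refl | yes a≡b = ⊥-elim (a≢b a≡b)
    ... | yes refl | no _    = sym (+-identityʳ _)
    ... | no _     | yes refl = refl
    ... | no y≢a   | no y≢b   = cong ind (leaves-independent x y x≢a x≢b y≢a y≢b)

  centres-degree : deg G a + deg G b ≡ N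
  centres-degree = begin
    deg G a + deg G b                    ≡⟨ ∑-distrib-+ (λ x → ind (G a x)) (λ x → ind (G b x)) ⟨
    ∑[ x < N ] (ind (G a x) + ind (G b x)) ≡⟨ sum-cong-≗ centres-cover ⟩
    ∑[ x < N ] 1                         ≡⟨ ∑-one N ⟩
    N                                    ∎

  degree-pointwise : ∀ x → deg G x + (point a 1 x + point b 1 x)
                         ≡ (point a (deg G a) x + point b (deg G b) x) + 1
  degree-pointwise x with x ≟ a | x ≟ b
  ... | yes refl | yes a≡b = ⊥-elim (a≢b a≡b)
  ... | yes refl | no _     = cong (_+ 1) (sym (+-identityʳ _))
  ... | no _     | yes refl = refl
  ... | no x≢a   | no x≢b   = trans (+-identityʳ _) (leaf-degree x x≢a x≢b)

  doubled : (edges G + 1) + (edges G + 1) ≡ N + N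
  doubled = begin
    (edges G + 1) + (edges G + 1)
      ≡⟨ interchange (edges G) 1 (edges G) 1 ⟩
    (edges G + edges G) + (1 + 1)
      ≡⟨ cong₂ _+_ (sym (handshake sym-G irr)) (cong₂ _+_ (∑-point a 1) (∑-point b 1)) ⟨
    ∑[ x < N ] deg G x + (sum (point a 1) + sum (point b 1))
      ≡⟨ cong (sum (deg G) +_) (∑-distrib-+ (point a 1) (point b 1)) ⟨
    ∑[ x < N ] deg G x + ∑[ x < N ] (point a 1 x + point b 1 x)
      ≡⟨ ∑-distrib-+ (deg G) (λ x → point a 1 x + point b 1 x) ⟨
    ∑[ x < N ] (deg G x + (point a 1 x + point b 1 x))
      ≡⟨ sum-cong-≗ degree-pointwise ⟩
    ∑[ x < N ] ((point a (deg G a) x + point b (deg G b) x) + 1)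
      ≡⟨ ∑-distrib-+ (λ x → point a (deg G a) x + point b (deg G b) x) (λ _ → 1) ⟩
    ∑[ x < N ] (point a (deg G a) x + point b (deg G b) x) + ∑[ x < N ] 1
      ≡⟨ cong₂ _+_ (trans (∑-distrib-+ (point a (deg G a)) (point b (deg G b)))
                          (cong₂ _+_ (∑-point a (deg G a)) (∑-point b (deg G b))))
                   (∑-one N) ⟩
    (deg G a + deg G b) + N
      ≡⟨ cong (_+ N) centres-degree ⟩
    N + N ∎

-- The orbit of K_{A,B}

data Shape : Set where
  bipartite bipartite+cliqueA bipartite+cliqueB : Shape
  binaryStar cliqueA+hubB cliqueB+hubA : Shape

-- The adjacency of u and w in a graph of the given shape with centres a ∈ A and
-- b ∈ B, as a function of e = [u = w], au = [a = u], bu = [b = u], pu = [u ∈ A]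
-- and the same atoms for w.
adjacency : Shape → (e au aw bu bw pu pw : Bool) → Bool
adjacency bipartite         e au aw bu bw pu pw = pu xor pw
adjacency bipartite+cliqueA e au aw bu bw pu pw = (pu xor pw) ∨ (pu ∧ pw ∧ not e)
adjacency bipartite+cliqueB e au aw bu bw pu pw = (pu xor pw) ∨ (not pu ∧ not pw ∧ not e)
adjacency binaryStar        e au aw bu bw pu pw =
  not e ∧ ((au ∧ pw) ∨ (aw ∧ pu) ∨ (bu ∧ not pw) ∨ (bw ∧ not pu) ∨ (au ∧ bw) ∨ (bu ∧ aw))
adjacency cliqueA+hubB      e au aw bu bw pu pw = not e ∧ ((pu ∧ pw) ∨ bu ∨ bw)
adjacency cliqueB+hubA      e au aw bu bw pu pw = not e ∧ ((not pu ∧ not pw) ∨ au ∨ aw)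

data Recentre : Set where
  stay moveA moveB : Recentre

-- Local complementation at v, as a function of [a = v], [b = v] and [v ∈ A]:
-- the new shape, and which centre (if any) moves to v.
transition : Shape → (av bv pv : Bool) → Shape × Recentre
transition bipartite         _     _     true  = bipartite+cliqueB , stay
transition bipartite         _     _     false = bipartite+cliqueA , stay
transition bipartite+cliqueA _     _     true  = cliqueB+hubA , moveA
transition bipartite+cliqueA _     _     false = bipartite , stay
transition bipartite+cliqueB _     _     true  = bipartite , stay
transition bipartite+cliqueB _     _     false = cliqueA+hubB , moveB
transition binaryStar        true  _     _     = cliqueA+hubB , stay
transition binaryStar        false true  _     = cliqueB+hubA , stay
transition binaryStar        false false _     = binaryStar , stay
transition cliqueA+hubB      _     true  _     = bipartite+cliqueB , stay
transition cliqueA+hubB      _     false true  = binaryStar , moveA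
transition cliqueA+hubB      _     false false = cliqueA+hubB , stay
transition cliqueB+hubA      true  _     _     = bipartite+cliqueA , stay
transition cliqueB+hubA      false _     false = binaryStar , moveB
transition cliqueB+hubA      false _     true  = cliqueB+hubA , stay

moveA-inA : ∀ s av bv pv → proj₂ (transition s av bv pv) ≡ moveA → pv ≡ true
moveA-inA s                 av    bv    true  _ = refl
moveA-inA bipartite         av    bv    false ()
moveA-inA bipartite+cliqueA av    bv    false ()
moveA-inA bipartite+cliqueB av    bv    false ()
moveA-inA binaryStar        true  bv    false ()
moveA-inA binaryStar        false true  false ()
moveA-inA binaryStar        false false false ()
moveA-inA cliqueA+hubB      av    true  false ()
moveA-inA cliqueA+hubB      av    false false ()
moveA-inA cliqueB+hubA      true  bv    false ()
moveA-inA cliqueB+hubA      false bv    false ()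

moveB-inB : ∀ s av bv pv → proj₂ (transition s av bv pv) ≡ moveB → pv ≡ false
moveB-inB s                 av    bv    false _ = refl
moveB-inB bipartite         av    bv    true  ()
moveB-inB bipartite+cliqueA av    bv    true  ()
moveB-inB bipartite+cliqueB av    bv    true  ()
moveB-inB binaryStar        true  bv    true  ()
moveB-inB binaryStar        false true  true  ()
moveB-inB binaryStar        false false true  ()
moveB-inB cliqueA+hubB      av    true  true  ()
moveB-inB cliqueA+hubB      av    false true  ()
moveB-inB cliqueB+hubA      true  bv    true  ()
moveB-inB cliqueB+hubA      false bv    true  ()

recentreA recentreB : Recentre → (vx cx : Bool) → Bool
recentreA moveA vx cx = vx
recentreA _     vx cx = cx
recentreB moveB vx cx = vx
recentreB _     vx cx = cx

eqTriangle : (e₁ e₂ e₃ : Bool) → Bool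
eqTriangle e₁ e₂ e₃ = ((e₁ ∧ e₂) ⇒ᵇ e₃) ∧ ((e₁ ∧ e₃) ⇒ᵇ e₂) ∧ ((e₂ ∧ e₃) ⇒ᵇ e₁)

-- Atoms of five points v, x, y, a, b that can occur together when a ∈ A, b ∉ A.
consistent : (xy vx vy av ax ay bv bx by pv px py : Bool) → Bool
consistent xy vx vy av ax ay bv bx by pv px py =
  eqTriangle vx xy vy ∧ eqTriangle ax xy ay ∧ eqTriangle bx xy by ∧
  eqTriangle av vx ax ∧ eqTriangle av vy ay ∧ eqTriangle bv vx bx ∧ eqTriangle bv vy by ∧
  (xy ⇒ᵇ (px == py)) ∧ (vx ⇒ᵇ (pv == px)) ∧ (vy ⇒ᵇ (pv == py)) ∧
  (av ⇒ᵇ pv) ∧ (ax ⇒ᵇ px) ∧ (ay ⇒ᵇ py) ∧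
  (bv ⇒ᵇ not pv) ∧ (bx ⇒ᵇ not px) ∧ (by ⇒ᵇ not py)

lcAdjacency : Shape → (xy vx vy av ax ay bv bx by pv px py : Bool) → Bool
lcAdjacency s xy vx vy av ax ay bv bx by pv px py =
  if not xy ∧ adjacency s vx av ax bv bx pv px ∧ adjacency s vy av ay bv by pv py
  then not (adjacency s xy ax ay bx by px py) else adjacency s xy ax ay bx by px py

transitionAdjacency : Shape → (xy vx vy av ax ay bv bx by pv px py : Bool) → Bool
transitionAdjacency s xy vx vy av ax ay bv bx by pv px py =
  adjacency s′ xy (recentreA r vx ax) (recentreA r vy ay) (recentreB r vx bx) (recentreB r vy by) px py
  where
  s′ = proj₁ (transition s av bv pv)
  r  = proj₂ (transition s av bv pv)

transition-correct : Shape → Vec Bool 12 → Bool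
transition-correct s (xy ∷ vx ∷ vy ∷ av ∷ ax ∷ ay ∷ bv ∷ bx ∷ by ∷ pv ∷ px ∷ py ∷ []) =
  consistent xy vx vy av ax ay bv bx by pv px py ⇒ᵇ
  (lcAdjacency s xy vx vy av ax ay bv bx by pv px py == transitionAdjacency s xy vx vy av ax ay bv bx by pv px py)

transition-isTautology : ∀ s → isTautology 12 (transition-correct s) ≡ true
transition-isTautology bipartite         = refl
transition-isTautology bipartite+cliqueA = refl
transition-isTautology bipartite+cliqueB = refl
transition-isTautology binaryStar        = refl
transition-isTautology cliqueA+hubB      = refl
transition-isTautology cliqueB+hubA      = refl

adjacency-symmetric : Shape → Vec Bool 7 → Bool
adjacency-symmetric s (e ∷ au ∷ aw ∷ bu ∷ bw ∷ pu ∷ pw ∷ []) =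
  adjacency s e au aw bu bw pu pw == adjacency s e aw au bw bu pw pu

adjacency-symmetric-isTautology : ∀ s → isTautology 7 (adjacency-symmetric s) ≡ true
adjacency-symmetric-isTautology bipartite         = refl
adjacency-symmetric-isTautology bipartite+cliqueA = refl
adjacency-symmetric-isTautology bipartite+cliqueB = refl
adjacency-symmetric-isTautology binaryStar        = refl
adjacency-symmetric-isTautology cliqueA+hubB      = refl
adjacency-symmetric-isTautology cliqueB+hubA      = refl

adjacency-irreflexive : Shape → Vec Bool 3 → Bool
adjacency-irreflexive s (au ∷ bu ∷ pu ∷ []) = not (adjacency s true au au bu bu pu pu)

adjacency-irreflexive-isTautology : ∀ s → isTautology 3 (adjacency-irreflexive s) ≡ true
adjacency-irreflexive-isTautology bipartite         = refl
adjacency-irreflexive-isTautology bipartite+cliqueA = refl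
adjacency-irreflexive-isTautology bipartite+cliqueB = refl
adjacency-irreflexive-isTautology binaryStar        = refl
adjacency-irreflexive-isTautology cliqueA+hubB      = refl
adjacency-irreflexive-isTautology cliqueB+hubA      = refl

adjacency-⊆ : Shape → Shape → Vec Bool 7 → Bool
adjacency-⊆ s s′ (e ∷ au ∷ aw ∷ bu ∷ bw ∷ pu ∷ pw ∷ []) =
  ((au ⇒ᵇ pu) ∧ (aw ⇒ᵇ pw) ∧ (bu ⇒ᵇ not pu) ∧ (bw ⇒ᵇ not pw)) ⇒ᵇ
  (adjacency s e au aw bu bw pu pw ⇒ᵇ adjacency s′ e au aw bu bw pu pw)

binaryStar⊆cliqueA+hubB : isTautology 7 (adjacency-⊆ binaryStar cliqueA+hubB) ≡ true
binaryStar⊆cliqueA+hubB = refl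

binaryStar⊆cliqueB+hubA : isTautology 7 (adjacency-⊆ binaryStar cliqueB+hubA) ≡ true
binaryStar⊆cliqueB+hubA = refl

module OrbitShapes {N : ℕ} (inA : Fin N → Bool) where

  infix 4 _≡ᵇ_

  _≡ᵇ_ : Fin N → Fin N → Bool
  u ≡ᵇ w = does (u ≟ w)

  ≡ᵇ-refl : ∀ u → (u ≡ᵇ u) ≡ true
  ≡ᵇ-refl u with u ≟ u
  ... | yes _   = refl
  ... | no u≢u = ⊥-elim (u≢u refl)

  ≡ᵇ-false : ∀ {u w} → ¬ u ≡ w → (u ≡ᵇ w) ≡ false
  ≡ᵇ-false {u} {w} u≢w with u ≟ w
  ... | yes u≡w = ⊥-elim (u≢w u≡w)
  ... | no _    = refl

  ≡ᵇ-sym : ∀ u w → (u ≡ᵇ w) ≡ (w ≡ᵇ u)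
  ≡ᵇ-sym u w with u ≟ w
  ... | yes refl = sym (≡ᵇ-refl u)
  ... | no u≢w   = sym (≡ᵇ-false (u≢w ∘ sym))

  ≡ᵇ-triangle : ∀ u w z → eqTriangle (u ≡ᵇ w) (w ≡ᵇ z) (u ≡ᵇ z) ≡ true
  ≡ᵇ-triangle u w z with u ≟ w | w ≟ z | u ≟ z
  ... | yes _   | yes _   | yes _   = refl
  ... | yes u≡w | yes w≡z | no u≢z  = ⊥-elim (u≢z (trans u≡w w≡z))
  ... | yes u≡w | no w≢z  | yes u≡z = ⊥-elim (w≢z (trans (sym u≡w) u≡z))
  ... | no u≢w  | yes w≡z | yes u≡z = ⊥-elim (u≢w (trans u≡z (sym w≡z)))
  ... | yes _   | no _    | no _    = refl
  ... | no _    | yes _   | no _    = refl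
  ... | no _    | no _    | yes _   = refl
  ... | no _    | no _    | no _    = refl

  inA-respects-≡ : ∀ u w → ((u ≡ᵇ w) ⇒ᵇ (inA u == inA w)) ≡ true
  inA-respects-≡ u w with u ≟ w
  ... | yes refl = ==-refl (inA u)
    where
    ==-refl : ∀ b → (b == b) ≡ true
    ==-refl true  = refl
    ==-refl false = refl
  ... | no _ = refl

  centre-inA : ∀ {a} → inA a ≡ true → ∀ u → ((a ≡ᵇ u) ⇒ᵇ inA u) ≡ true
  centre-inA {a} a∈A u with a ≟ u
  ... | yes refl = a∈A
  ... | no _     = refl

  centre-inB : ∀ {b} → inA b ≡ false → ∀ u → ((b ≡ᵇ u) ⇒ᵇ not (inA u)) ≡ true
  centre-inB {b} b∉A u with b ≟ u
  ... | yes refl = cong not b∉A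
  ... | no _     = refl

  atoms-consistent : ∀ {a b} → inA a ≡ true → inA b ≡ false → ∀ v x y →
    consistent (x ≡ᵇ y) (v ≡ᵇ x) (v ≡ᵇ y) (a ≡ᵇ v) (a ≡ᵇ x) (a ≡ᵇ y)
               (b ≡ᵇ v) (b ≡ᵇ x) (b ≡ᵇ y) (inA v) (inA x) (inA y) ≡ true
  atoms-consistent {a} {b} a∈A b∉A v x y =
    ≡ᵇ-triangle v x y ⟨∧⟩ ≡ᵇ-triangle a x y ⟨∧⟩ ≡ᵇ-triangle b x y ⟨∧⟩
    ≡ᵇ-triangle a v x ⟨∧⟩ ≡ᵇ-triangle a v y ⟨∧⟩ ≡ᵇ-triangle b v x ⟨∧⟩ ≡ᵇ-triangle b v y ⟨∧⟩
    inA-respects-≡ x y ⟨∧⟩ inA-respects-≡ v x ⟨∧⟩ inA-respects-≡ v y ⟨∧⟩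
    centre-inA a∈A v ⟨∧⟩ centre-inA a∈A x ⟨∧⟩ centre-inA a∈A y ⟨∧⟩
    centre-inB b∉A v ⟨∧⟩ centre-inB b∉A x ⟨∧⟩ centre-inB b∉A y

  data Config : Set where
    ⟨_,_,_⟩ : Shape → Fin N → Fin N → Config

  graphOf : Config → Graph N
  graphOf ⟨ s , a , b ⟩ u w =
    adjacency s (u ≡ᵇ w) (a ≡ᵇ u) (a ≡ᵇ w) (b ≡ᵇ u) (b ≡ᵇ w) (inA u) (inA w)

  WellCentred : Config → Set
  WellCentred ⟨ _ , a , b ⟩ = inA a ≡ true × inA b ≡ false

  applyTransition : (v a b : Fin N) → Shape × Recentre → Config
  applyTransition v a b (s , stay)  = ⟨ s , a , b ⟩
  applyTransition v a b (s , moveA) = ⟨ s , v , b ⟩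
  applyTransition v a b (s , moveB) = ⟨ s , a , v ⟩

  lcConfig : Fin N → Config → Config
  lcConfig v ⟨ s , a , b ⟩ = applyTransition v a b (transition s (a ≡ᵇ v) (b ≡ᵇ v) (inA v))

  lcConfig-wellCentred : ∀ v c → WellCentred c → WellCentred (lcConfig v c)
  lcConfig-wellCentred v ⟨ s , a , b ⟩ (a∈A , b∉A) with transition s (a ≡ᵇ v) (b ≡ᵇ v) (inA v) in eq
  ... | _ , stay  = a∈A , b∉A
  ... | _ , moveA = moveA-inA s _ _ _ (cong proj₂ eq) , b∉A
  ... | _ , moveB = a∈A , moveB-inB s _ _ _ (cong proj₂ eq)

  lc-graphOf : ∀ c → WellCentred c → ∀ v → lc v (graphOf c) ≈G graphOf (lcConfig v c)
  lc-graphOf ⟨ s , a , b ⟩ (a∈A , b∉A) v x y = trans by-table recentred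
    where
    by-table : lc v (graphOf ⟨ s , a , b ⟩) x y ≡
      transitionAdjacency s (x ≡ᵇ y) (v ≡ᵇ x) (v ≡ᵇ y) (a ≡ᵇ v) (a ≡ᵇ x) (a ≡ᵇ y)
                            (b ≡ᵇ v) (b ≡ᵇ x) (b ≡ᵇ y) (inA v) (inA x) (inA y)
    by-table = ==-sound (⇒ᵇ-elim
      (isTautology-sound 12 (transition-correct s) (transition-isTautology s)
        ((x ≡ᵇ y) ∷ (v ≡ᵇ x) ∷ (v ≡ᵇ y) ∷ (a ≡ᵇ v) ∷ (a ≡ᵇ x) ∷ (a ≡ᵇ y) ∷
         (b ≡ᵇ v) ∷ (b ≡ᵇ x) ∷ (b ≡ᵇ y) ∷ inA v ∷ inA x ∷ inA y ∷ []))
      (atoms-consistent a∈A b∉A v x y))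
    recentred : transitionAdjacency s (x ≡ᵇ y) (v ≡ᵇ x) (v ≡ᵇ y) (a ≡ᵇ v) (a ≡ᵇ x) (a ≡ᵇ y)
                  (b ≡ᵇ v) (b ≡ᵇ x) (b ≡ᵇ y) (inA v) (inA x) (inA y)
              ≡ graphOf (lcConfig v ⟨ s , a , b ⟩) x y
    recentred with transition s (a ≡ᵇ v) (b ≡ᵇ v) (inA v)
    ... | _ , stay  = refl
    ... | _ , moveA = refl
    ... | _ , moveB = refl

  lc-cong : ∀ {G H : Graph N} → G ≈G H → ∀ v → lc v G ≈G lc v H
  lc-cong G≈H v x y rewrite G≈H v x | G≈H v y | G≈H x y = refl

  inOrbit-config : ∀ c₀ {H} → WellCentred c₀ → InOrbit (graphOf c₀) H →
    Σ Config λ c → WellCentred c × graphOf c ≈G H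
  inOrbit-config c₀ wc₀ (here G≈H) = c₀ , wc₀ , G≈H
  inOrbit-config c₀ wc₀ (step v orbit lcH≈H′) with inOrbit-config c₀ wc₀ orbit
  ... | c , wc , G≈H = lcConfig v c , lcConfig-wellCentred v c wc ,
    λ x y → trans (sym (lc-graphOf c wc v x y)) (trans (lc-cong G≈H v x y) (lcH≈H′ x y))

  lcConfig-inOrbit : ∀ {G} c → WellCentred c → InOrbit G (graphOf c) → ∀ v → InOrbit G (graphOf (lcConfig v c))
  lcConfig-inOrbit c wc orbit v = step v orbit (lc-graphOf c wc v)

  graphOf-symmetric : ∀ c → Symmetric (graphOf c)
  graphOf-symmetric ⟨ s , a , b ⟩ u w = trans
    (==-sound (isTautology-sound 7 (adjacency-symmetric s) (adjacency-symmetric-isTautology s)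
      ((u ≡ᵇ w) ∷ (a ≡ᵇ u) ∷ (a ≡ᵇ w) ∷ (b ≡ᵇ u) ∷ (b ≡ᵇ w) ∷ inA u ∷ inA w ∷ [])))
    (cong (λ e → adjacency s e (a ≡ᵇ w) (a ≡ᵇ u) (b ≡ᵇ w) (b ≡ᵇ u) (inA w) (inA u)) (≡ᵇ-sym u w))

  graphOf-irreflexive : ∀ c → Irreflexive (graphOf c)
  graphOf-irreflexive ⟨ s , a , b ⟩ u rewrite ≡ᵇ-refl u =
    trans (sym (not-involutive _)) (cong not
      (isTautology-sound 3 (adjacency-irreflexive s) (adjacency-irreflexive-isTautology s)
        ((a ≡ᵇ u) ∷ (b ≡ᵇ u) ∷ inA u ∷ [])))

  graphOf-⊆ : ∀ s s′ → isTautology 7 (adjacency-⊆ s s′) ≡ true →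
    ∀ a b → WellCentred ⟨ s , a , b ⟩ → graphOf ⟨ s , a , b ⟩ ⊆ᴳ graphOf ⟨ s′ , a , b ⟩
  graphOf-⊆ s s′ taut a b (a∈A , b∉A) u w = ⇒ᵇ-elim (⇒ᵇ-elim
    (isTautology-sound 7 (adjacency-⊆ s s′) taut
      ((u ≡ᵇ w) ∷ (a ≡ᵇ u) ∷ (a ≡ᵇ w) ∷ (b ≡ᵇ u) ∷ (b ≡ᵇ w) ∷ inA u ∷ inA w ∷ []))
    (centre-inA a∈A u ⟨∧⟩ centre-inA a∈A w ⟨∧⟩ centre-inB b∉A u ⟨∧⟩ centre-inB b∉A w))

  bipartite⊆bipartite+cliqueA : ∀ a b → graphOf ⟨ bipartite , a , b ⟩ ⊆ᴳ graphOf ⟨ bipartite+cliqueA , a , b ⟩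
  bipartite⊆bipartite+cliqueA _ _ u w uw = cong (_∨ (inA u ∧ inA w ∧ not (u ≡ᵇ w))) uw

  bipartite⊆bipartite+cliqueB : ∀ a b → graphOf ⟨ bipartite , a , b ⟩ ⊆ᴳ graphOf ⟨ bipartite+cliqueB , a , b ⟩
  bipartite⊆bipartite+cliqueB _ _ u w uw = cong (_∨ (not (inA u) ∧ not (inA w) ∧ not (u ≡ᵇ w))) uw

  sides-distinct : ∀ {u w} → inA u ≡ true → inA w ≡ false → ¬ u ≡ w
  sides-distinct u∈A w∉A refl with trans (sym u∈A) w∉A
  ... | ()

  binaryStar-isBinaryStar : ∀ a b → WellCentred ⟨ binaryStar , a , b ⟩ →
    IsBinaryStar (graphOf ⟨ binaryStar , a , b ⟩)
  binaryStar-isBinaryStar a b (a∈A , b∉A) = a , b , a≢b , centres-adjacent , one-centre , leaves-independent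
    where
    a≢b : ¬ a ≡ b
    a≢b = sides-distinct a∈A b∉A

    centres-adjacent : graphOf ⟨ binaryStar , a , b ⟩ a b ≡ true
    centres-adjacent rewrite ≡ᵇ-false a≢b | ≡ᵇ-false (a≢b ∘ sym) | ≡ᵇ-refl a | ≡ᵇ-refl b | a∈A | b∉A = refl

    one-centre : ∀ x → ¬ x ≡ a → ¬ x ≡ b →
      (graphOf ⟨ binaryStar , a , b ⟩ a x xor graphOf ⟨ binaryStar , a , b ⟩ b x) ≡ true
    one-centre x x≢a x≢b
      rewrite ≡ᵇ-false a≢b | ≡ᵇ-false (a≢b ∘ sym) | ≡ᵇ-refl a | ≡ᵇ-refl b | a∈A | b∉A
            | ≡ᵇ-false (x≢a ∘ sym) | ≡ᵇ-false (x≢b ∘ sym) with inA x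
    ... | true  = refl
    ... | false = refl

    leaves-independent : ∀ x y → ¬ x ≡ a → ¬ x ≡ b → ¬ y ≡ a → ¬ y ≡ b →
      graphOf ⟨ binaryStar , a , b ⟩ x y ≡ false
    leaves-independent x y x≢a x≢b y≢a y≢b
      rewrite ≡ᵇ-false (x≢a ∘ sym) | ≡ᵇ-false (x≢b ∘ sym) | ≡ᵇ-false (y≢a ∘ sym) | ≡ᵇ-false (y≢b ∘ sym) =
      ∧-zeroʳ (not (x ≡ᵇ y))

  graphOf-binaryStar-edges : ∀ c → IsBinaryStar (graphOf c) → edges (graphOf c) ≡ N ∸ 1
  graphOf-binaryStar-edges c = binaryStar-edges (graphOf-symmetric c) (graphOf-irreflexive c)

  IsBinaryStar-cong : ∀ {G H : Graph N} → G ≈G H → IsBinaryStar G → IsBinaryStar H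
  IsBinaryStar-cong G≈H (a , b , a≢b , Gab , one-centre , leaves-independent) =
    a , b , a≢b , trans (sym (G≈H a b)) Gab ,
    (λ x x≢a x≢b → trans (sym (cong₂ _xor_ (G≈H a x) (G≈H b x))) (one-centre x x≢a x≢b)) ,
    (λ x y x≢a x≢b y≢a y≢b → trans (sym (G≈H x y)) (leaves-independent x y x≢a x≢b y≢a y≢b))

  module MinimalEdges (a₀ a₁ b₀ b₁ : Fin N)
    (a₀∈A : inA a₀ ≡ true) (a₁∈A : inA a₁ ≡ true) (b₀∉A : inA b₀ ≡ false) (b₁∉A : inA b₁ ≡ false)
    (a₀≢a₁ : ¬ a₀ ≡ a₁) (b₀≢b₁ : ¬ b₀ ≡ b₁)
    (A≺B : ∀ u w → inA u ≡ true → inA w ≡ false → u ≺ w ≡ true) where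

    ≤⇒∸1< : ∀ {e} → N ≤ e → N ∸ 1 < e
    ≤⇒∸1< = lemma a₀
      where
      lemma : ∀ {M e} → Fin M → M ≤ e → M ∸ 1 < e
      lemma {suc M} _ M<e = M<e

    -- Both sides have at least two vertices, so every vertex of K_{A,B} has degree at least 2.
    bipartite-edges : ∀ a b → N ∸ 1 < edges (graphOf ⟨ bipartite , a , b ⟩)
    bipartite-edges a b = ≤⇒∸1< (+-double-cancel-≤ (begin
      N + N                    ≡⟨ cong₂ _+_ (∑-one N) (∑-one N) ⟨
      ∑[ x < N ] 1 + ∑[ x < N ] 1 ≡⟨ ∑-distrib-+ {N} (λ _ → 1) (λ _ → 1) ⟨
      ∑[ x < N ] 2              ≤⟨ ∑-mono-≤ degree-≥2 ⟩
      ∑[ x < N ] deg G x        ≡⟨ handshake (graphOf-symmetric c) (graphOf-irreflexive c) ⟨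
      edges G + edges G         ∎))
      where
      open ≤-Reasoning
      c : Config
      c = ⟨ bipartite , a , b ⟩
      G : Graph N
      G = graphOf c
      degree-≥2 : ∀ x → 2 ≤ deg G x
      degree-≥2 x = opposite-pair (inA x) refl
        where
        two-neighbours : ∀ {y z} → ¬ y ≡ z → G x y ≡ true → G x z ≡ true → 2 ≤ deg G x
        two-neighbours y≢z xy xz =
          subst (_≤ deg G x) (cong₂ (λ u v → ind u + ind v) xy xz) (∑-≥-pair (λ y → ind (G x y)) y≢z)
        opposite-pair : ∀ p → inA x ≡ p → 2 ≤ deg G x
        opposite-pair true  x∈A = two-neighbours b₀≢b₁ (cong₂ _xor_ x∈A b₀∉A) (cong₂ _xor_ x∈A b₁∉A)
        opposite-pair false x∉A = two-neighbours a₀≢a₁ (cong₂ _xor_ x∉A a₀∈A) (cong₂ _xor_ x∉A a₁∈A)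

    cliqueA+hubB-edges : ∀ a b → WellCentred ⟨ cliqueA+hubB , a , b ⟩ →
      N ∸ 1 < edges (graphOf ⟨ cliqueA+hubB , a , b ⟩)
    cliqueA+hubB-edges a b (_ , b∉A) = subst (_< edges (graphOf ⟨ cliqueA+hubB , a , b ⟩))
      (graphOf-binaryStar-edges ⟨ binaryStar , a₀ , b ⟩ (binaryStar-isBinaryStar a₀ b (a₀∈A , b∉A)))
      (edges-mono-< (graphOf-⊆ binaryStar cliqueA+hubB binaryStar⊆cliqueA+hubB a₀ b (a₀∈A , b∉A))
        a₁ b (A≺B a₁ b a₁∈A b∉A) star-misses hub-adjacent)
      where
      a₁≢b : ¬ a₁ ≡ b
      a₁≢b = sides-distinct a₁∈A b∉A
      star-misses : graphOf ⟨ binaryStar , a₀ , b ⟩ a₁ b ≡ false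
      star-misses rewrite ≡ᵇ-false a₁≢b | ≡ᵇ-false (a₁≢b ∘ sym) | ≡ᵇ-false a₀≢a₁
        | ≡ᵇ-false (sides-distinct a₀∈A b∉A) | ≡ᵇ-refl b | a₁∈A = refl
      hub-adjacent : graphOf ⟨ cliqueA+hubB , a₀ , b ⟩ a₁ b ≡ true
      hub-adjacent rewrite ≡ᵇ-false a₁≢b | ≡ᵇ-false (a₁≢b ∘ sym) | ≡ᵇ-refl b | a₁∈A | b∉A = refl

    cliqueB+hubA-edges : ∀ a b → WellCentred ⟨ cliqueB+hubA , a , b ⟩ →
      N ∸ 1 < edges (graphOf ⟨ cliqueB+hubA , a , b ⟩)
    cliqueB+hubA-edges a b (a∈A , _) = subst (_< edges (graphOf ⟨ cliqueB+hubA , a , b ⟩))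
      (graphOf-binaryStar-edges ⟨ binaryStar , a , b₀ ⟩ (binaryStar-isBinaryStar a b₀ (a∈A , b₀∉A)))
      (edges-mono-< (graphOf-⊆ binaryStar cliqueB+hubA binaryStar⊆cliqueB+hubA a b₀ (a∈A , b₀∉A))
        a b₁ (A≺B a b₁ a∈A b₁∉A) star-misses hub-adjacent)
      where
      a≢b₁ : ¬ a ≡ b₁
      a≢b₁ = sides-distinct a∈A b₁∉A
      star-misses : graphOf ⟨ binaryStar , a , b₀ ⟩ a b₁ ≡ false
      star-misses rewrite ≡ᵇ-false a≢b₁ | ≡ᵇ-false b₀≢b₁
        | ≡ᵇ-false (sides-distinct a∈A b₀∉A ∘ sym) | ≡ᵇ-refl a | b₁∉A = refl
      hub-adjacent : graphOf ⟨ cliqueB+hubA , a , b₀ ⟩ a b₁ ≡ true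
      hub-adjacent rewrite ≡ᵇ-false a≢b₁ | ≡ᵇ-refl a | a∈A = refl

    binaryStar-or-more : ∀ c → WellCentred c → IsBinaryStar (graphOf c) ⊎ N ∸ 1 < edges (graphOf c)
    binaryStar-or-more ⟨ bipartite         , a , b ⟩ _  = inj₂ (bipartite-edges a b)
    binaryStar-or-more ⟨ bipartite+cliqueA , a , b ⟩ _  =
      inj₂ (<-≤-trans (bipartite-edges a b) (edges-mono (bipartite⊆bipartite+cliqueA a b)))
    binaryStar-or-more ⟨ bipartite+cliqueB , a , b ⟩ _  =
      inj₂ (<-≤-trans (bipartite-edges a b) (edges-mono (bipartite⊆bipartite+cliqueB a b)))
    binaryStar-or-more ⟨ binaryStar        , a , b ⟩ wc = inj₁ (binaryStar-isBinaryStar a b wc)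
    binaryStar-or-more ⟨ cliqueA+hubB      , a , b ⟩ wc = inj₂ (cliqueA+hubB-edges a b wc)
    binaryStar-or-more ⟨ cliqueB+hubA      , a , b ⟩ wc = inj₂ (cliqueB+hubA-edges a b wc)

    orbit-edges-≥ : ∀ c → WellCentred c → N ∸ 1 ≤ edges (graphOf c)
    orbit-edges-≥ c wc with binaryStar-or-more c wc
    ... | inj₁ star = ≤-reflexive (sym (graphOf-binaryStar-edges c star))
    ... | inj₂ more = <⇒≤ more

    K₀ : Graph N
    K₀ = graphOf ⟨ bipartite , a₀ , b₀ ⟩

    star₀ : Config
    star₀ = ⟨ binaryStar , a₀ , b₀ ⟩

    -- K_{A,B}, then K_{A,B} plus a clique on B, then a clique on A with hub b₀, then the star.
    star₀-reached : lcConfig a₀ (lcConfig b₀ (lcConfig a₀ ⟨ bipartite , a₀ , b₀ ⟩)) ≡ star₀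
    star₀-reached rewrite a₀∈A | b₀∉A | ≡ᵇ-false (sides-distinct a₀∈A b₀∉A ∘ sym) | a₀∈A = refl

    star₀-inOrbit : InOrbit K₀ (graphOf star₀)
    star₀-inOrbit = subst (InOrbit K₀ ∘ graphOf) star₀-reached
      (lcConfig-inOrbit c₂ wc₂
        (lcConfig-inOrbit c₁ wc₁
          (lcConfig-inOrbit c₀ wc₀ (here (λ _ _ → refl)) a₀) b₀) a₀)
      where
      c₀ c₁ c₂ : Config
      c₀ = ⟨ bipartite , a₀ , b₀ ⟩
      c₁ = lcConfig a₀ c₀
      c₂ = lcConfig b₀ c₁
      wc₀ : WellCentred c₀
      wc₀ = a₀∈A , b₀∉A
      wc₁ : WellCentred c₁
      wc₁ = lcConfig-wellCentred a₀ c₀ wc₀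
      wc₂ : WellCentred c₂
      wc₂ = lcConfig-wellCentred b₀ c₁ wc₁

    minimal-iff-binaryStar : ∀ G → InOrbit K₀ G →
      ((IsMinInOrbit K₀ G → IsBinaryStar G) × (IsBinaryStar G → IsMinInOrbit K₀ G))
      × (IsBinaryStar G → edges G ≡ N ∸ 1)
    minimal-iff-binaryStar G orbit with inOrbit-config ⟨ bipartite , a₀ , b₀ ⟩ (a₀∈A , b₀∉A) orbit
    ... | c , wc , c≈G = (minimal⇒binaryStar , binaryStar⇒minimal) , binaryStar⇒edges
      where
      G≈c : G ≈G graphOf c
      G≈c x y = sym (c≈G x y)

      binaryStar⇒edges : IsBinaryStar G → edges G ≡ N ∸ 1
      binaryStar⇒edges star =
        trans (edges-cong G≈c) (graphOf-binaryStar-edges c (IsBinaryStar-cong G≈c star))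

      minimal⇒binaryStar : IsMinInOrbit K₀ G → IsBinaryStar G
      minimal⇒binaryStar minimal with binaryStar-or-more c wc
      ... | inj₁ star = IsBinaryStar-cong c≈G star
      ... | inj₂ more = ⊥-elim (<⇒≱ more (begin
        edges (graphOf c)     ≡⟨ edges-cong c≈G ⟩
        edges G               ≤⟨ minimal (graphOf star₀) star₀-inOrbit ⟩
        edges (graphOf star₀) ≡⟨ graphOf-binaryStar-edges star₀ (binaryStar-isBinaryStar a₀ b₀ (a₀∈A , b₀∉A)) ⟩
        N ∸ 1                 ∎))
        where open ≤-Reasoning

      binaryStar⇒minimal : IsBinaryStar G → IsMinInOrbit K₀ G
      binaryStar⇒minimal star H orbitH with inOrbit-config ⟨ bipartite , a₀ , b₀ ⟩ (a₀∈A , b₀∉A) orbitH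
      ... | c′ , wc′ , c′≈H = begin
        edges G            ≡⟨ binaryStar⇒edges star ⟩
        N ∸ 1              ≤⟨ orbit-edges-≥ c′ wc′ ⟩
        edges (graphOf c′) ≡⟨ edges-cong c′≈H ⟩
        edges H            ∎
        where open ≤-Reasoning

↑ʳ-outside : ∀ n {m} (j : Fin m) → (toℕ (n ↑ʳ j) <ᵇ n) ≡ false
↑ʳ-outside n j rewrite toℕ-↑ʳ n j = <ᵇ-false (≤⇒≯ (m≤m+n n (toℕ j)))

threshold-≺ : ∀ {N} n (u w : Fin N) → (toℕ u <ᵇ n) ≡ true → (toℕ w <ᵇ n) ≡ false → u ≺ w ≡ true
threshold-≺ n u w u<n w≮n = <ᵇ-true (<-≤-trans (<ᵇ⇒< (toℕ u) n (Equivalence.from T-≡ u<n)) n≤w)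
  where
  n≤w : n ≤ toℕ w
  n≤w = ≮⇒≥ (λ w<n → contradiction (trans (sym (<ᵇ-true w<n)) w≮n) λ ())

theorem5 : (n m : ℕ) → 2 ≤ n → 2 ≤ m → (G : Graph (n + m)) → InOrbit (K n m) G →
    ((IsMinInOrbit (K n m) G → IsBinaryStar G) × (IsBinaryStar G → IsMinInOrbit (K n m) G))
    × (IsBinaryStar G → edges G ≡ n + m ∸ 1)
theorem5 n m (s≤s (s≤s _)) (s≤s (s≤s _)) =
  OrbitShapes.MinimalEdges.minimal-iff-binaryStar (λ x → toℕ x <ᵇ n)
    zero (suc zero) (n ↑ʳ zero) (n ↑ʳ suc zero)
    refl refl (↑ʳ-outside n zero) (↑ʳ-outside n (suc zero))
    (λ ()) (0≢1+n ∘ ↑ʳ-injective n zero (suc zero))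
    (threshold-≺ n)
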